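{- Fix integers $k \ge 3$ and $i \in \{2,\dots,k-1\}$. Let $d \ge 1$ and let $X \subset \mathbb{Z}_k^d$ be a hole in $\mathbb{Z}_k^d$. Then for any distinct elements $x_1,\dots,x_m \in X$, the set $(X\setminus\{x_1,\dots,x_m\})^{\dagger m}$ is a hole in $\mathbb{Z}_k^{d+m}$.
   Context: $\mathbb{Z}_k$ denotes the integers modulo $k$. Let $T=\{1,\dots,k\}\setminus\{i\}$, identified with its image in $\mathbb{Z}_k$. A copy of $T$ in $\mathbb{Z}_k^d$ is a set $\{y+te_j : t\in\mathbb{Z}_k,\ t\neq a\}$ with $y\in\mathbb{Z}_k^d$, $j\in\{1,\dots,d\}$, $a\in\mathbb{Z}_k$. A set $X\subset\mathbb{Z}_k^d$ is a hole in $\mathbb{Z}_k^d$ if $\mathbb{Z}_k^d\setminus X$ is a disjoint union of copies of $T$. Let $c_{j,d}=(k-1)e_j\in\mathbb{Z}_k^d$. For $S\subset\mathbb{Z}_k^d$ define $S^{\dagger}=(S\times\{0\})\cup\{c_{d+1,d+1}\}\subset\mathbb{Z}_k^{d+1}$, and $S^{\dagger m}\subset\mathbb{Z}_k^{d+m}$ denotes the result of $m$ successive applications of $\dagger$ (each time regarding the set as a subset of the current torus). -}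

module Defs where

open import Data.Nat using (ℕ; zero; suc; _+_; _∸_; NonZero)
open import Data.Nat.DivMod using (_%_; m%n<n)
open import Data.Fin using (Fin; toℕ; fromℕ; fromℕ<; _≟_)
open import Data.Fin.Properties using (any?)
open import Data.Vec using (Vec; []; _∷_; zipWith; tabulate; init; last)
open import Data.Vec.Properties using (≡-dec)
open import Data.Bool using (Bool; true; false; _∧_; not; _∨_; if_then_else_)
open import Data.List using (List; length; lookup)
open import Data.Product using (Σ; _×_; _,_; ∃)
open import Relation.Binary.PropositionalEquality using (_≡_; _≢_)
open import Relation.Nullary using (¬_)
open import Relation.Nullary.Decidable using (⌊_⌋)

ℤ : ℕ → Set
ℤ k = Fin k

[_]ₖ : ∀ {k} .{{_ : NonZero k}} → ℕ → ℤ k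
[_]ₖ {k} n = fromℕ< (m%n<n n k)

_+ₖ_ : ∀ {k} .{{_ : NonZero k}} → ℤ k → ℤ k → ℤ k
a +ₖ b = [ toℕ a + toℕ b ]ₖ

Pt : ℕ → ℕ → Set
Pt k d = Vec (ℤ k) d

_⊕_ : ∀ {k d} .{{_ : NonZero k}} → Pt k d → Pt k d → Pt k d
_⊕_ = zipWith _+ₖ_

_·e_ : ∀ {k d} .{{_ : NonZero k}} → ℤ k → Fin d → Pt k d
t ·e j = tabulate λ l → if ⌊ l ≟ j ⌋ then t else [ 0 ]ₖ

Subset : ℕ → ℕ → Set
Subset k d = Pt k d → Bool

_∈_ : ∀ {k d} → Pt k d → Subset k d → Set
p ∈ S = S p ≡ true

-- a copy of T, given by (y , j , a):  { y + t e_j : t ∈ ℤ_k , t ≠ a }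
Copy : ℕ → ℕ → Set
Copy k d = Pt k d × Fin d × ℤ k

InCopy : ∀ {k d} .{{_ : NonZero k}} → Pt k d → Copy k d → Set
InCopy {k} p (y , j , a) = Σ (ℤ k) λ t → (t ≢ a) × (p ≡ y ⊕ (t ·e j))

-- X is a hole: the complement of X is the disjoint union of a (finite)
-- family of copies of T.  Points of X lie in no copy; every point outside X
-- lies in exactly one member of the family.
IsHole : ∀ {k d} .{{_ : NonZero k}} → Subset k d → Set
IsHole {k} {d} X = Σ (List (Copy k d)) λ L → (p : Pt k d) →
    (p ∈ X → (ι : Fin (length L)) → ¬ InCopy p (lookup L ι))
  × (¬ (p ∈ X) → Σ (Fin (length L)) λ ι → InCopy p (lookup L ι)
                   × ((ι′ : Fin (length L)) → InCopy p (lookup L ι′) → ι′ ≡ ι))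

c : ∀ {k d} .{{_ : NonZero k}} → Fin d → Pt k d
c {k} j = [ k ∸ 1 ]ₖ ·e j

lastIdx : (d : ℕ) → Fin (suc d)
lastIdx = fromℕ

-- S† = (S × {0}) ∪ {c_{d+1,d+1}}, where the new coordinate is the last one:
-- p ∈ S† iff (last p = 0 and init p ∈ S) or p = c_{d+1,d+1}.
_† : ∀ {k d} .{{_ : NonZero k}} → Subset k d → Subset k (suc d)
_† {k} {d} S p =
  (⌊ last p ≟ [ 0 ]ₖ ⌋ ∧ S (init p)) ∨ ⌊ ≡-dec _≟_ p (c (lastIdx d)) ⌋

_†^_ : ∀ {k d} .{{_ : NonZero k}} → Subset k d → (m : ℕ) → Subset k (m + d)
S †^ zero = S
S †^ suc m = (S †^ m) †

_∖_ : ∀ {k d m} → Subset k d → (Fin m → Pt k d) → Subset k d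
(X ∖ x) p = X p ∧ not ⌊ any? (λ r → ≡-dec _≟_ p (x r)) ⌋

-- A copy of T in ℤ_k^d is a line parallel to an axis with one point removed,
-- so a hole is a subset whose complement is tiled by such punctured lines.
-- The proof builds tilings explicitly, layer by layer along the last axis.

module Submission where

open import Defs
open import Data.Nat using (ℕ; zero; suc; _+_; _∸_; _≤_; _<_; s≤s; NonZero; >-nonZero⁻¹)
open import Data.Nat.Properties using (n<1+n; ≤-trans; n≤1+n; +-identityʳ)
open import Data.Nat.DivMod using (m<n⇒m%n≡m)
open import Data.Fin using (Fin; zero; suc; toℕ; inject₁; fromℕ; _≟_)
open import Data.Fin.Properties using (toℕ-fromℕ<; toℕ-injective; toℕ<n; fromℕ≢inject₁; inject₁-injective; suc-injective; 0≢1+n; any?)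
open import Data.Vec using ([]; _∷_; _∷ʳ_; init; last; initLast; tabulate; replicate)
open import Data.Vec.Properties using (init-∷ʳ; last-∷ʳ; ≡-dec; tabulate-cong; zipWith-identityʳ; ∷-injective)
open import Data.List using (List; []; _∷_; _++_; map; concat; length; lookup)
import Data.List as List
open import Data.List.Relation.Unary.All as All using (All; []; _∷_; universal)
open import Data.List.Relation.Unary.All.Properties using (++⁺; map⁺; concat⁺; tabulate⁺)
open import Data.List.Membership.Propositional.Properties using (∈-lookup)
open import Data.Bool using (Bool; true; false; _∧_; _∨_; not; if_then_else_)
open import Data.Bool.Properties using (∧-identityʳ; ∧-zeroʳ; ∨-identityʳ; ¬-not)
open import Data.Product using (Σ; _×_; _,_; proj₁; proj₂)
open import Data.Empty using (⊥-elim)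
open import Function using (_∘_; _⇔_; mk⇔; Equivalence)
open import Function.Definitions using (Injective)
open import Relation.Nullary using (¬_; Dec; yes; no)
open import Relation.Nullary.Decidable using (⌊_⌋; isYes≗does; dec-true; dec-false; does-⇔)
open import Relation.Binary.PropositionalEquality using (_≡_; _≢_; refl; sym; trans; cong; cong₂; module ≡-Reasoning)

open Equivalence using (to; from)

⌊⌋-true : ∀ {A : Set} (a? : Dec A) → A → ⌊ a? ⌋ ≡ true
⌊⌋-true a? a = trans (isYes≗does a?) (dec-true a? a)

⌊⌋-false : ∀ {A : Set} (a? : Dec A) → ¬ A → ⌊ a? ⌋ ≡ false
⌊⌋-false a? ¬a = trans (isYes≗does a?) (dec-false a? ¬a)

⌊⌋-⇔ : ∀ {A B : Set} → A ⇔ B → (a? : Dec A) (b? : Dec B) → ⌊ a? ⌋ ≡ ⌊ b? ⌋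
⌊⌋-⇔ A⇔B a? b? = trans (isYes≗does a?) (trans (does-⇔ A⇔B a? b?) (sym (isYes≗does b?)))

module _ {C : Set} where

  None : (C → Set) → List C → Set
  None P = All (¬_ ∘ P)

  data One (P : C → Set) : List C → Set where
    here  : ∀ {x xs} → P x → None P xs → One P (x ∷ xs)
    there : ∀ {x xs} → ¬ P x → One P xs → One P (x ∷ xs)

  One-++ˡ : ∀ {P xs ys} → One P xs → None P ys → One P (xs ++ ys)
  One-++ˡ (here px nxs) nys = here px (++⁺ nxs nys)
  One-++ˡ (there ¬px o) nys = there ¬px (One-++ˡ o nys)

  One-++ʳ : ∀ {P xs ys} → None P xs → One P ys → One P (xs ++ ys)
  One-++ʳ []          o = o
  One-++ʳ (¬px ∷ nxs) o = there ¬px (One-++ʳ nxs o)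

  One-⇔ : ∀ {P Q xs} → (∀ x → P x ⇔ Q x) → One P xs → One Q xs
  One-⇔ P⇔Q (here px nxs) = here (to (P⇔Q _) px) (All.map (λ ¬p → ¬p ∘ from (P⇔Q _)) nxs)
  One-⇔ P⇔Q (there ¬px o) = there (¬px ∘ from (P⇔Q _)) (One-⇔ P⇔Q o)

  One-concat : ∀ {P m} (F : Fin m → List C) (t₀ : Fin m) → One P (F t₀) →
               (∀ t → t ≢ t₀ → None P (F t)) → One P (concat (List.tabulate F))
  One-concat F zero     o others = One-++ˡ o (concat⁺ (tabulate⁺ λ t → others (suc t) λ ()))
  One-concat F (suc t₀) o others =
    One-++ʳ (others zero λ ()) (One-concat (F ∘ suc) t₀ o λ t t≢t₀ → others (suc t) (t≢t₀ ∘ suc-injective))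

One-map⁺ : ∀ {C D : Set} {P : D → Set} {f : C → D} {xs} → One (P ∘ f) xs → One P (map f xs)
One-map⁺ (here px nxs) = here px (map⁺ nxs)
One-map⁺ (there ¬px o) = there ¬px (One-map⁺ o)

None⇒lookup : ∀ {C : Set} {P : C → Set} {L} → None P L → ∀ ι → ¬ P (lookup L ι)
None⇒lookup n ι = All.lookup n (∈-lookup ι)

lookup⇒None : ∀ {C : Set} {P : C → Set} L → (∀ ι → ¬ P (lookup L ι)) → None P L
lookup⇒None []      _ = []
lookup⇒None (x ∷ L) f = f zero ∷ lookup⇒None L (f ∘ suc)

UniqueIndex : ∀ {C : Set} (P : C → Set) (L : List C) → Set
UniqueIndex P L = Σ (Fin (length L)) λ ι → P (lookup L ι) × ((ι′ : Fin (length L)) → P (lookup L ι′) → ι′ ≡ ι)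

One⇒index : ∀ {C : Set} {P : C → Set} {L} → One P L → UniqueIndex P L
One⇒index (here px nxs) = zero , px , λ { zero _ → refl ; (suc ι′) p → ⊥-elim (None⇒lookup nxs ι′ p) }
One⇒index (there ¬px o) with One⇒index o
... | ι , p , unique = suc ι , p , λ { zero p′ → ⊥-elim (¬px p′) ; (suc ι′) p′ → cong suc (unique ι′ p′) }

index⇒One : ∀ {C : Set} {P : C → Set} L → UniqueIndex P L → One P L
index⇒One (x ∷ L) (zero , p , unique) = here p (lookup⇒None L λ ι p′ → 0≢1+n (sym (unique (suc ι) p′)))
index⇒One (x ∷ L) (suc ι , p , unique) =
  there (λ p′ → 0≢1+n (unique zero p′)) (index⇒One L (ι , p , λ ι′ p′ → suc-injective (unique (suc ι′) p′)))

module Torus (k : ℕ) .{{_ : NonZero k}} where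

  0ₖ : ℤ k
  0ₖ = [ 0 ]ₖ

  top : ℤ k
  top = [ k ∸ 1 ]ₖ

  zeros : (n : ℕ) → Pt k n
  zeros n = replicate n 0ₖ

  _≟ₚ_ : ∀ {n} (u v : Pt k n) → Dec (u ≡ v)
  _≟ₚ_ = ≡-dec _≟_

  toℕ-[] : ∀ {n} → n < k → toℕ ([_]ₖ {k} n) ≡ n
  toℕ-[] n<k = trans (toℕ-fromℕ< _) (m<n⇒m%n≡m n<k)

  [toℕ] : (a : ℤ k) → [ toℕ a ]ₖ ≡ a
  [toℕ] a = toℕ-injective (toℕ-[] (toℕ<n a))

  toℕ-0ₖ : toℕ 0ₖ ≡ 0
  toℕ-0ₖ = toℕ-[] (>-nonZero⁻¹ k)

  +ₖ-identityʳ : (a : ℤ k) → a +ₖ 0ₖ ≡ a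
  +ₖ-identityʳ a = trans (cong (λ z → [ toℕ a + z ]ₖ) toℕ-0ₖ) (trans (cong [_]ₖ (+-identityʳ (toℕ a))) ([toℕ] a))

  +ₖ-identityˡ : (a : ℤ k) → 0ₖ +ₖ a ≡ a
  +ₖ-identityˡ a = trans (cong (λ z → [ z + toℕ a ]ₖ) toℕ-0ₖ) ([toℕ] a)

  0≢top : 2 ≤ k → 0ₖ ≢ top
  0≢top k≥2 0≡top = k∸1≢0 k≥2 (trans (sym (toℕ-[] (k∸1<k k≥2))) (trans (cong toℕ (sym 0≡top)) toℕ-0ₖ))
    where
    k∸1<k : ∀ {k} → 2 ≤ k → k ∸ 1 < k
    k∸1<k (s≤s _) = n<1+n _
    k∸1≢0 : ∀ {k} → 2 ≤ k → k ∸ 1 ≢ 0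
    k∸1≢0 (s≤s (s≤s _)) ()

  ∷ʳ-view : ∀ {n} (w : Pt k (suc n)) → w ≡ init w ∷ʳ last w
  ∷ʳ-view w = proj₂ (proj₂ (initLast w))

  ≡∷ʳ⇒ : ∀ {n} {w : Pt k (suc n)} {u t} → w ≡ u ∷ʳ t → init w ≡ u × last w ≡ t
  ≡∷ʳ⇒ {u = u} {t} refl = init-∷ʳ t u , last-∷ʳ t u

  ⇒≡∷ʳ : ∀ {n} {w : Pt k (suc n)} {u t} → init w ≡ u → last w ≡ t → w ≡ u ∷ʳ t
  ⇒≡∷ʳ {w = w} u≡ t≡ = trans (∷ʳ-view w) (cong₂ _∷ʳ_ u≡ t≡)

  ≟-∷ʳ : ∀ {n} (w : Pt k (suc n)) v a → ⌊ w ≟ₚ (v ∷ʳ a) ⌋ ≡ ⌊ last w ≟ a ⌋ ∧ ⌊ init w ≟ₚ v ⌋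
  ≟-∷ʳ w v a with last w ≟ a | init w ≟ₚ v
  ... | yes t≡ | yes u≡ = ⌊⌋-true (w ≟ₚ _) (⇒≡∷ʳ u≡ t≡)
  ... | yes _  | no u≢  = ⌊⌋-false (w ≟ₚ _) (u≢ ∘ proj₁ ∘ ≡∷ʳ⇒)
  ... | no t≢  | _      = ⌊⌋-false (w ≟ₚ _) (t≢ ∘ proj₂ ∘ ≡∷ʳ⇒)

  ⊕-∷ʳ : ∀ {n} (u v : Pt k n) a b → (u ∷ʳ a) ⊕ (v ∷ʳ b) ≡ (u ⊕ v) ∷ʳ (a +ₖ b)
  ⊕-∷ʳ []      []      a b = refl
  ⊕-∷ʳ (x ∷ u) (y ∷ v) a b = cong ((x +ₖ y) ∷_) (⊕-∷ʳ u v a b)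

  ⊕-zeros : ∀ {n} (u : Pt k n) → u ⊕ zeros n ≡ u
  ⊕-zeros = zipWith-identityʳ +ₖ-identityʳ

  tabulate-∷ʳ : ∀ {n} {A : Set} (f : Fin (suc n) → A) → tabulate f ≡ tabulate (f ∘ inject₁) ∷ʳ f (fromℕ n)
  tabulate-∷ʳ {zero}  f = refl
  tabulate-∷ʳ {suc n} f = cong (f zero ∷_) (tabulate-∷ʳ (f ∘ suc))

  tabulate-const : ∀ {n} {A : Set} (x : A) → tabulate {n = n} (λ _ → x) ≡ replicate n x
  tabulate-const {zero}  x = refl
  tabulate-const {suc n} x = cong (x ∷_) (tabulate-const x)

  ·e-inject₁ : ∀ {n} (t : ℤ k) (j : Fin n) → t ·e inject₁ j ≡ (t ·e j) ∷ʳ 0ₖ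
  ·e-inject₁ {n} t j = trans (tabulate-∷ʳ (λ l → pick ⌊ l ≟ inject₁ j ⌋))
                               (cong₂ _∷ʳ_ (tabulate-cong λ l → cong pick (same-test l)) (cong pick last-test))
    where
    pick : Bool → ℤ k
    pick b = if b then t else 0ₖ
    same-test : ∀ l → ⌊ inject₁ l ≟ inject₁ j ⌋ ≡ ⌊ l ≟ j ⌋
    same-test l = ⌊⌋-⇔ (mk⇔ inject₁-injective (cong inject₁)) _ _
    last-test : ⌊ fromℕ n ≟ inject₁ j ⌋ ≡ false
    last-test = ⌊⌋-false _ fromℕ≢inject₁

  ·e-fromℕ : ∀ {n} (t : ℤ k) → t ·e fromℕ n ≡ zeros n ∷ʳ t
  ·e-fromℕ {n} t = trans (tabulate-∷ʳ (λ l → pick ⌊ l ≟ fromℕ n ⌋))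
                           (cong₂ _∷ʳ_ (trans (tabulate-cong λ l → cong pick (other-test l)) (tabulate-const 0ₖ))
                                       (cong pick (⌊⌋-true _ refl)))
    where
    pick : Bool → ℤ k
    pick b = if b then t else 0ₖ
    other-test : ∀ l → ⌊ inject₁ l ≟ fromℕ n ⌋ ≡ false
    other-test l = ⌊⌋-false _ (fromℕ≢inject₁ ∘ sym)

  c-test : ∀ {n} (w : Pt k (suc n)) → ⌊ w ≟ₚ c (lastIdx n) ⌋ ≡ ⌊ last w ≟ top ⌋ ∧ ⌊ init w ≟ₚ zeros n ⌋
  c-test {n} w = trans (cong (λ v → ⌊ w ≟ₚ v ⌋) (·e-fromℕ top)) (≟-∷ʳ w (zeros n) top)

  lift : ∀ {n} → ℤ k → Copy k n → Copy k (suc n)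
  lift t (y , j , a) = (y ∷ʳ t , inject₁ j , a)

  vertical : ∀ {n} → Pt k n → ℤ k → Copy k (suc n)
  vertical {n} v a = (v ∷ʳ 0ₖ , fromℕ n , a)

  InCopy-lift : ∀ {n} (w : Pt k (suc n)) t (cp : Copy k n) →
                InCopy w (lift t cp) ⇔ (last w ≡ t × InCopy (init w) cp)
  InCopy-lift w t (y , j , a) = mk⇔
    (λ { (s , s≢a , w≡) → let u≡ , t≡ = ≡∷ʳ⇒ (trans w≡ (point s)) in t≡ , s , s≢a , u≡ })
    (λ { (t≡ , s , s≢a , u≡) → s , s≢a , trans (⇒≡∷ʳ u≡ t≡) (sym (point s)) })
    where
    point : ∀ s → (y ∷ʳ t) ⊕ (s ·e inject₁ j) ≡ (y ⊕ (s ·e j)) ∷ʳ t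
    point s = begin
      (y ∷ʳ t) ⊕ (s ·e inject₁ j)     ≡⟨ cong ((y ∷ʳ t) ⊕_) (·e-inject₁ s j) ⟩
      (y ∷ʳ t) ⊕ ((s ·e j) ∷ʳ 0ₖ)     ≡⟨ ⊕-∷ʳ y (s ·e j) t 0ₖ ⟩
      (y ⊕ (s ·e j)) ∷ʳ (t +ₖ 0ₖ)     ≡⟨ cong ((y ⊕ (s ·e j)) ∷ʳ_) (+ₖ-identityʳ t) ⟩
      (y ⊕ (s ·e j)) ∷ʳ t             ∎
      where open ≡-Reasoning

  InCopy-vertical : ∀ {n} (w : Pt k (suc n)) v a → InCopy w (vertical v a) ⇔ (init w ≡ v × last w ≢ a)
  InCopy-vertical {n} w v a = mk⇔
    (λ { (s , s≢a , w≡) → let u≡ , t≡ = ≡∷ʳ⇒ (trans w≡ (point s)) in u≡ , λ t≡a → s≢a (trans (sym t≡) t≡a) })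
    (λ { (u≡ , t≢a) → last w , t≢a , trans (⇒≡∷ʳ u≡ refl) (sym (point (last w))) })
    where
    point : ∀ s → (v ∷ʳ 0ₖ) ⊕ (s ·e fromℕ n) ≡ v ∷ʳ s
    point s = begin
      (v ∷ʳ 0ₖ) ⊕ (s ·e fromℕ n)     ≡⟨ cong ((v ∷ʳ 0ₖ) ⊕_) (·e-fromℕ s) ⟩
      (v ∷ʳ 0ₖ) ⊕ (zeros n ∷ʳ s)     ≡⟨ ⊕-∷ʳ v (zeros n) 0ₖ s ⟩
      (v ⊕ zeros n) ∷ʳ (0ₖ +ₖ s)     ≡⟨ cong₂ _∷ʳ_ (⊕-zeros v) (+ₖ-identityˡ s) ⟩
      v ∷ʳ s                         ∎
      where open ≡-Reasoning

  allPts : (n : ℕ) → List (Pt k n)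
  allPts zero    = [] ∷ []
  allPts (suc n) = concat (List.tabulate λ x → map (x ∷_) (allPts n))

  One-allPts : ∀ {n} {Q : Pt k n → Set} (q : Pt k n) → Q q → (∀ v → v ≢ q → ¬ Q v) → One Q (allPts n)
  One-allPts []      Qq _    = here Qq []
  One-allPts {suc n} {Q} (x ∷ q) Qq only =
    One-concat _ x (One-map⁺ (One-allPts {Q = Q ∘ (x ∷_)} q Qq λ v v≢q → only (x ∷ v) (v≢q ∘ proj₂ ∘ ∷-injective)))
      λ y y≢x → map⁺ (universal (λ v → only (y ∷ v) (y≢x ∘ proj₁ ∘ ∷-injective)) (allPts n))

  Tiles : ∀ {n} → Subset k n → List (Copy k n) → Set
  Tiles {n} S L = (w : Pt k n) → (w ∈ S → None (InCopy w) L) × (S w ≡ false → One (InCopy w) L)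

  Tiling : ∀ {n} → Subset k n → Set
  Tiling {n} S = Σ (List (Copy k n)) (Tiles S)

  Tiling⇒IsHole : ∀ {n} {S : Subset k n} → Tiling S → IsHole S
  Tiling⇒IsHole (L , tiles) = L , λ w → None⇒lookup ∘ proj₁ (tiles w) , λ w∉S → One⇒index (proj₂ (tiles w) (¬-not w∉S))

  IsHole⇒Tiling : ∀ {n} {S : Subset k n} → IsHole S → Tiling S
  IsHole⇒Tiling (L , hole) = L , λ w →
      lookup⇒None L ∘ proj₁ (hole w)
    , λ Sw≡false → index⇒One L (proj₂ (hole w) λ w∈S → false≢true (trans (sym Sw≡false) w∈S))
    where
    false≢true : false ≢ true
    false≢true ()

  Tiling-resp : ∀ {n} {A B : Subset k n} → (∀ w → A w ≡ B w) → Tiling A → Tiling B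
  Tiling-resp A≗B (L , tiles) = L , λ w → proj₁ (tiles w) ∘ trans (A≗B w) , proj₂ (tiles w) ∘ trans (A≗B w)

  full-tiling : ∀ {n} → Tiling {n} (λ _ → true)
  full-tiling = [] , λ _ → (λ _ → []) , λ ()

  Tiling-if : ∀ {n} {A B : Subset k n} (b : Bool) → Tiling A → Tiling B → Tiling (λ u → if b then A u else B u)
  Tiling-if true  tA _  = tA
  Tiling-if false _  tB = tB

  Tiling-∧ : ∀ {n} {A B : Subset k n} → Tiling A → Tiling B → (∀ w → A w ≡ false → B w ≡ true) →
             Tiling (λ w → A w ∧ B w)
  Tiling-∧ {A = A} {B} (L₁ , tiles₁) (L₂ , tiles₂) disjoint = L₁ ++ L₂ , cover
    where
    cover : Tiles (λ w → A w ∧ B w) (L₁ ++ L₂)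
    cover w with A w in w∈A | B w in w∈B
    ... | true  | true  = (λ _ → ++⁺ (proj₁ (tiles₁ w) w∈A) (proj₁ (tiles₂ w) w∈B)) , λ ()
    ... | true  | false = (λ ()) , λ _ → One-++ʳ (proj₁ (tiles₁ w) w∈A) (proj₂ (tiles₂ w) w∈B)
    ... | false | true  = (λ ()) , λ _ → One-++ˡ (proj₂ (tiles₁ w) w∈A) (proj₁ (tiles₂ w) w∈B)
    ... | false | false with () ← trans (sym w∈B) (disjoint w w∈A)

  stack-tiling : ∀ {n} (Y : ℤ k → Subset k n) → ((t : ℤ k) → Tiling (Y t)) → Tiling (λ w → Y (last w) (init w))
  stack-tiling Y T = concat (List.tabulate λ t → map (lift t) (proj₁ (T t))) , λ w →
      (λ w∈ → concat⁺ (tabulate⁺ λ t → slice-None w t w∈))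
    , (λ w∉ → One-concat _ (last w) (One-map⁺ (One-⇔ (on-slice w) (proj₂ (proj₂ (T (last w)) (init w)) w∉)))
                (λ t t≢ → off-slice w t t≢ _))
    where
    on-slice : ∀ w cp → InCopy (init w) cp ⇔ InCopy w (lift (last w) cp)
    on-slice w cp = mk⇔ (λ ic → from (InCopy-lift w (last w) cp) (refl , ic)) (proj₂ ∘ to (InCopy-lift w (last w) cp))
    off-slice : ∀ w t → t ≢ last w → ∀ cps → None (InCopy w) (map (lift t) cps)
    off-slice w t t≢ cps = map⁺ (universal (λ cp ic → t≢ (sym (proj₁ (to (InCopy-lift w t cp) ic)))) cps)
    slice-None : ∀ w t → Y (last w) (init w) ≡ true → None (InCopy w) (map (lift t) (proj₁ (T t)))
    slice-None w t w∈ with t ≟ last w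
    ... | yes refl = map⁺ (All.map (λ ¬ic → ¬ic ∘ from (on-slice w _)) (proj₁ (proj₂ (T t) (init w)) w∈))
    ... | no t≢    = off-slice w t t≢ _

  verticals-tiling : ∀ {n} (a : ℤ k) → Tiling {suc n} (λ w → ⌊ last w ≟ a ⌋)
  verticals-tiling {n} a = map (λ v → vertical v a) (allPts n) , cover
    where
    cover : Tiles (λ w → ⌊ last w ≟ a ⌋) (map (λ v → vertical v a) (allPts n))
    cover w with last w ≟ a
    ... | yes t≡a = (λ _ → map⁺ (universal (λ v ic → proj₂ (to (InCopy-vertical w v a) ic) t≡a) (allPts n))) , λ ()
    ... | no t≢a  = (λ ()) , λ _ → One-map⁺ (One-allPts (init w) (from (InCopy-vertical w (init w) a) (refl , t≢a))
                                     λ v v≢ ic → v≢ (sym (proj₁ (to (InCopy-vertical w v a) ic))))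

  -- Every single point is a hole: its slice is a point hole in one dimension
  -- less, the other slices are covered by the vertical lines.
  point-tiling : ∀ {n} (s : Pt k n) → Tiling (λ w → ⌊ w ≟ₚ s ⌋)
  point-tiling []          = [] , λ { [] → (λ _ → []) , λ () }
  point-tiling {suc n} s = Tiling-resp same (Tiling-∧ (verticals-tiling (last s)) (stack-tiling Y T) disjoint)
    where
    Y : ℤ k → Subset k n
    Y t u = if ⌊ t ≟ last s ⌋ then ⌊ u ≟ₚ init s ⌋ else true
    T : ∀ t → Tiling (Y t)
    T t = Tiling-if ⌊ t ≟ last s ⌋ (point-tiling (init s)) full-tiling
    disjoint : ∀ w → ⌊ last w ≟ last s ⌋ ≡ false → Y (last w) (init w) ≡ true
    disjoint w with last w ≟ last s
    ... | yes _ = λ ()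
    ... | no _  = λ _ → refl
    on-slice : ∀ w → ⌊ last w ≟ last s ⌋ ∧ Y (last w) (init w) ≡ ⌊ last w ≟ last s ⌋ ∧ ⌊ init w ≟ₚ init s ⌋
    on-slice w with last w ≟ last s
    ... | yes _ = refl
    ... | no _  = refl
    same : ∀ w → ⌊ last w ≟ last s ⌋ ∧ Y (last w) (init w) ≡ ⌊ w ≟ₚ s ⌋
    same w = trans (on-slice w) (trans (sym (≟-∷ʳ w (init s) (last s))) (cong (λ v → ⌊ w ≟ₚ v ⌋) (sym (∷ʳ-view s))))

  _∖₁_ : ∀ {n} → Subset k n → Pt k n → Subset k n
  (S ∖₁ p) u = not ⌊ u ≟ₚ p ⌋ ∧ S u

  remove-head : ∀ {d m} (X : Subset k d) (x : Fin (suc m) → Pt k d) u → (X ∖ x) u ≡ ((X ∖ (x ∘ suc)) ∖₁ x zero) u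
  remove-head X x u = begin
    X u ∧ not ⌊ any? hit? ⌋                               ≡⟨ cong (λ b → X u ∧ not b) any?-suc ⟩
    X u ∧ not (⌊ hit? zero ⌋ ∨ ⌊ any? (hit? ∘ suc) ⌋)     ≡⟨ reorder (X u) ⌊ hit? zero ⌋ _ ⟩
    not ⌊ hit? zero ⌋ ∧ (X u ∧ not ⌊ any? (hit? ∘ suc) ⌋) ∎
    where
    open ≡-Reasoning
    hit? : ∀ r → Dec (u ≡ x r)
    hit? r = u ≟ₚ x r
    any?-suc : ⌊ any? hit? ⌋ ≡ ⌊ hit? zero ⌋ ∨ ⌊ any? (hit? ∘ suc) ⌋
    any?-suc = trans (isYes≗does (any? hit?)) (sym (cong₂ _∨_ (isYes≗does (hit? zero)) (isYes≗does (any? (hit? ∘ suc)))))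
    reorder : ∀ a b c → a ∧ not (b ∨ c) ≡ not b ∧ (a ∧ not c)
    reorder a true  c = ∧-zeroʳ a
    reorder a false c = refl

  remove-fresh : ∀ {d m} (X : Subset k d) (x : Fin m → Pt k d) {q} → (∀ r → q ≢ x r) → (X ∖ x) q ≡ X q
  remove-fresh X x {q} fresh = trans (cong (λ b → X q ∧ not b) (⌊⌋-false (any? λ r → q ≟ₚ x r) λ (r , q≡) → fresh r q≡))
                                     (∧-identityʳ (X q))

  dagger-at : ∀ {n} (S : Subset k n) w →
              (S †) w ≡ (⌊ last w ≟ 0ₖ ⌋ ∧ S (init w)) ∨ (⌊ last w ≟ top ⌋ ∧ ⌊ init w ≟ₚ zeros n ⌋)
  dagger-at S w = cong ((⌊ last w ≟ 0ₖ ⌋ ∧ S (init w)) ∨_) (c-test w)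

  dagger-cong : ∀ {n} {A B : Subset k n} → (∀ u → A u ≡ B u) → ∀ w → (A †) w ≡ (B †) w
  dagger-cong {n} A≗B w = cong (λ b → (⌊ last w ≟ 0ₖ ⌋ ∧ b) ∨ ⌊ w ≟ₚ c (lastIdx n) ⌋) (A≗B (init w))

  dagger-pow-cong : ∀ {n} {A B : Subset k n} m → (∀ u → A u ≡ B u) → ∀ w → (A †^ m) w ≡ (B †^ m) w
  dagger-pow-cong zero    A≗B = A≗B
  dagger-pow-cong (suc m) A≗B = dagger-cong (dagger-pow-cong m A≗B)

  pad : ∀ {d} m → Pt k d → Pt k (m + d)
  pad zero    p = p
  pad (suc m) p = pad m p ∷ʳ 0ₖ

  -- The facts below use k ≥ 2, so that heights 0 and k - 1 differ.
  module Dagger (k≥2 : 2 ≤ k) where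

    floor-not-top : ∀ t → ⌊ t ≟ 0ₖ ⌋ ∧ ⌊ t ≟ top ⌋ ≡ false
    floor-not-top t with t ≟ 0ₖ
    ... | no _    = refl
    ... | yes t≡0 = ⌊⌋-false (t ≟ top) λ t≡top → 0≢top k≥2 (trans (sym t≡0) t≡top)

    dagger-floor : ∀ {n} (S : Subset k n) u → (S †) (u ∷ʳ 0ₖ) ≡ S u
    dagger-floor {n} S u = begin
      (S †) (u ∷ʳ 0ₖ)                                  ≡⟨ dagger-at S (u ∷ʳ 0ₖ) ⟩
      test (last (u ∷ʳ 0ₖ)) (init (u ∷ʳ 0ₖ))           ≡⟨ cong₂ test (last-∷ʳ 0ₖ u) (init-∷ʳ 0ₖ u) ⟩
      (⌊ 0ₖ ≟ 0ₖ ⌋ ∧ S u) ∨ (⌊ 0ₖ ≟ top ⌋ ∧ origin u)   ≡⟨ cong₂ (λ a b → (a ∧ S u) ∨ (b ∧ origin u)) 0≟0 0≟top ⟩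
      S u ∨ false                                      ≡⟨ ∨-identityʳ (S u) ⟩
      S u                                              ∎
      where
      open ≡-Reasoning
      origin : Subset k n
      origin v = ⌊ v ≟ₚ zeros n ⌋
      test : ℤ k → Pt k n → Bool
      test t v = (⌊ t ≟ 0ₖ ⌋ ∧ S v) ∨ (⌊ t ≟ top ⌋ ∧ origin v)
      0≟0 : ⌊ 0ₖ ≟ 0ₖ ⌋ ≡ true
      0≟0 = ⌊⌋-true (0ₖ ≟ 0ₖ) refl
      0≟top : ⌊ 0ₖ ≟ top ⌋ ≡ false
      0≟top = ⌊⌋-false (0ₖ ≟ top) (0≢top k≥2)

    pad-∈ : ∀ {d} (S : Subset k d) m p → (S †^ m) (pad m p) ≡ S p
    pad-∈ S zero    p = refl
    pad-∈ S (suc m) p = trans (dagger-floor (S †^ m) (pad m p)) (pad-∈ S m p)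

    dagger-remove : ∀ {n} (S : Subset k n) p w → ((S ∖₁ p) †) w ≡ ((S †) ∖₁ (p ∷ʳ 0ₖ)) w
    dagger-remove {n} S p w = begin
      ((S ∖₁ p) †) w                                           ≡⟨ dagger-at (S ∖₁ p) w ⟩
      (z ∧ (not e ∧ S (init w))) ∨ (tp ∧ q)                    ≡⟨ commute z tp e (S (init w)) q (floor-not-top (last w)) ⟩
      not (z ∧ e) ∧ ((z ∧ S (init w)) ∨ (tp ∧ q))
        ≡⟨ cong₂ (λ a b → not a ∧ b) (sym (≟-∷ʳ w p 0ₖ)) (sym (dagger-at S w)) ⟩
      ((S †) ∖₁ (p ∷ʳ 0ₖ)) w                                   ∎
      where
      open ≡-Reasoning
      z = ⌊ last w ≟ 0ₖ ⌋
      tp = ⌊ last w ≟ top ⌋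
      e = ⌊ init w ≟ₚ p ⌋
      q = ⌊ init w ≟ₚ zeros n ⌋
      commute : ∀ z tp e s q → z ∧ tp ≡ false → (z ∧ (not e ∧ s)) ∨ (tp ∧ q) ≡ not (z ∧ e) ∧ ((z ∧ s) ∨ (tp ∧ q))
      commute true  true  _     _ _ ()
      commute true  false true  _ _ _ = refl
      commute true  false false _ _ _ = refl
      commute false _     _     _ _ _ = refl

    dagger-pow-remove : ∀ {d} (S : Subset k d) p m w → ((S ∖₁ p) †^ m) w ≡ ((S †^ m) ∖₁ pad m p) w
    dagger-pow-remove S p zero    w = refl
    dagger-pow-remove S p (suc m) w = trans (dagger-cong (dagger-pow-remove S p m) w) (dagger-remove (S †^ m) (pad m p) w)

    -- Off the
    -- vertical line over p (punctured at the top), the slices of the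
    -- complement are: H's complement at height 0, ℤ_k^n ∖ {0} at height k - 1
    -- (where c_{n+1,n+1} lies), and ℤ_k^n ∖ {p} at every other height.
    remove-dagger : ∀ {n} {H : Subset k n} → Tiling H → ∀ p → p ∈ H → Tiling ((H ∖₁ p) †)
    remove-dagger {n} {H} tH p p∈H = Tiling-resp same (Tiling-∧ column (stack-tiling Y T) disjoint)
      where
      Column : Subset k (suc n)
      Column w = not ⌊ init w ≟ₚ p ⌋ ∨ ⌊ last w ≟ top ⌋

      column : Tiling Column
      column = vertical p top ∷ [] , cover
        where
        cover : Tiles Column (vertical p top ∷ [])
        cover w with init w ≟ₚ p | last w ≟ top
        ... | yes u≡p | yes t≡top = (λ _ → (λ ic → proj₂ (to (InCopy-vertical w p top) ic) t≡top) ∷ []) , λ ()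
        ... | yes u≡p | no t≢top  = (λ ()) , λ _ → here (from (InCopy-vertical w p top) (u≡p , t≢top)) []
        ... | no u≢p  | _         = (λ _ → (λ ic → u≢p (proj₁ (to (InCopy-vertical w p top) ic))) ∷ []) , λ ()

      Y : ℤ k → Subset k n
      Y t u = if ⌊ t ≟ 0ₖ ⌋ then H u else if ⌊ t ≟ top ⌋ then ⌊ u ≟ₚ zeros n ⌋ else ⌊ u ≟ₚ p ⌋

      T : ∀ t → Tiling (Y t)
      T t = Tiling-if ⌊ t ≟ 0ₖ ⌋ tH (Tiling-if ⌊ t ≟ top ⌋ (point-tiling (zeros n)) (point-tiling p))

      -- The vertical line only meets slices in which its point is uncovered.
      disjoint : ∀ w → Column w ≡ false → Y (last w) (init w) ≡ true
      disjoint w with init w ≟ₚ p | last w ≟ top | last w ≟ 0ₖ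
      ... | yes u≡p | no _ | yes _ = λ _ → trans (cong H u≡p) p∈H
      ... | yes _   | no _ | no _  = λ _ → refl
      ... | yes _   | yes _ | _    = λ ()
      ... | no _    | _    | _     = λ ()

      same : ∀ w → Column w ∧ Y (last w) (init w) ≡ ((H ∖₁ p) †) w
      same w = trans (meet ⌊ last w ≟ 0ₖ ⌋ ⌊ last w ≟ top ⌋ ⌊ init w ≟ₚ p ⌋ ⌊ init w ≟ₚ zeros n ⌋ (H (init w))
                           (floor-not-top (last w)))
                     (sym (dagger-at (H ∖₁ p) w))
        where
        meet : ∀ z tp e q h → z ∧ tp ≡ false →
               (not e ∨ tp) ∧ (if z then h else if tp then q else e) ≡ (z ∧ (not e ∧ h)) ∨ (tp ∧ q)
        meet true  true  _     _ _ ()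
        meet true  false true  _ _ _ = refl
        meet true  false false _ h _ = sym (∨-identityʳ h)
        meet false true  true  _ _ _ = refl
        meet false true  false _ _ _ = refl
        meet false false true  _ _ _ = refl
        meet false false false _ _ _ = refl

    holes-after-removal : ∀ {d} {X : Subset k d} → Tiling X → ∀ {m} (x : Fin m → Pt k d) →
                          Injective _≡_ _≡_ x → (∀ r → x r ∈ X) → Tiling ((X ∖ x) †^ m)
    holes-after-removal {X = X} tX {zero} x _ _ = Tiling-resp (λ u → sym (remove-fresh X x λ ())) tX
    holes-after-removal {d} {X} tX {suc m} x inj x∈X =
      Tiling-resp (λ w → sym (dagger-cong same w)) (remove-dagger tail-hole (pad m (x zero)) head-in)
      where
      tail-hole : Tiling ((X ∖ (x ∘ suc)) †^ m)
      tail-hole = holes-after-removal tX (x ∘ suc) (suc-injective ∘ inj) (x∈X ∘ suc)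

      head-in : pad m (x zero) ∈ ((X ∖ (x ∘ suc)) †^ m)
      head-in = trans (pad-∈ (X ∖ (x ∘ suc)) m (x zero))
                      (trans (remove-fresh X (x ∘ suc) (λ r x₀≡ → 0≢1+n (inj x₀≡))) (x∈X zero))

      same : ∀ u → ((X ∖ x) †^ m) u ≡ (((X ∖ (x ∘ suc)) †^ m) ∖₁ pad m (x zero)) u
      same u = trans (dagger-pow-cong m (remove-head X x) u) (dagger-pow-remove (X ∖ (x ∘ suc)) (x zero) m u)

corollary6 : (k : ℕ) .{{_ : NonZero k}} → 3 ≤ k →
    (i : ℕ) → 2 ≤ i → i ≤ k ∸ 1 →
    (d : ℕ) → 1 ≤ d → (X : Subset k d) → IsHole X →
    (m : ℕ) → (x : Fin m → Pt k d) → Injective _≡_ _≡_ x →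
    ((r : Fin m) → x r ∈ X) →
    IsHole ((X ∖ x) †^ m)
corollary6 k k≥3 _ _ _ _ _ X hole m x inj x∈X =
  Tiling⇒IsHole (holes-after-removal (IsHole⇒Tiling hole) x inj x∈X)
  where
  open Torus k
  open Dagger (≤-trans (n≤1+n 2) k≥3)
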